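{- Let $p\geq 2$ be an integer. If $H$ is a contraction of $K_{2,p}$ and $H\neq K_{2,p}$, then $H\in\mathcal{D}\cup\mathcal{S}$.
   Context: Graphs are finite, simple, considered up to isomorphism. Contracting an edge $\{u,v\}$ means adding a new vertex adjacent to all neighbours of $u$ and $v$ and deleting $u,v$; $H$ is a contraction of $G$ if $H$ is obtained from $G$ by a sequence of edge contractions. For $r\in\mathbb{N}$, $D_r$ is the graph consisting of an edge $\{a_1,a_2\}$ together with $r$ further pairwise non-adjacent vertices each adjacent to both $a_1$ and $a_2$ (i.e. the complement of $K_r$ disjoint union two isolated vertices); $\mathcal{D}=\{D_r: r\in\mathbb{N}\}$. $\mathcal{S}=\{K_{1,r}: r\in\mathbb{N}\}$ is the class of stars. -}

module Defs where

open import Data.Nat using (ℕ; zero; suc; _<_; _≤_)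
open import Data.Nat.Properties using (_<?_)
open import Data.Fin using (Fin; toℕ; zero; suc)
open import Data.Bool using (Bool; true; false; _xor_; _∨_; _∧_; not)
open import Data.Product using (Σ; ∃; ∃-syntax; _×_; _,_)
open import Data.Sum using (_⊎_)
open import Relation.Nullary using (¬_)
open import Relation.Nullary.Decidable using (⌊_⌋)
open import Relation.Binary.PropositionalEquality using (_≡_; _≢_)
open import Function.Bundles using (_⤖_; _⇔_; Bijection)
open import Function.Definitions using (Surjective)
open import Relation.Binary.Construct.Closure.ReflexiveTransitive using (Star)

record Graph : Set where
  field
    n      : ℕ
    adj    : Fin n → Fin n → Bool
    sym    : ∀ x y → adj x y ≡ adj y x
    irrefl : ∀ x → adj x x ≡ false
open Graph public

Edge : (G : Graph) → Fin (n G) → Fin (n G) → Set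
Edge G x y = adj G x y ≡ true

record _≅_ (G H : Graph) : Set where
  field
    bij      : Fin (n G) ⤖ Fin (n H)
    preserve : ∀ x y → adj G x y ≡ adj H (Bijection.to bij x) (Bijection.to bij y)

-- So f u = f v is the new vertex, adjacent to all neighbours of u and v
-- (other than u,v themselves), and all other adjacencies are those of G.
record ContractEdge (G H : Graph) : Set where
  field
    u v      : Fin (n G)
    uv       : Edge G u v
    f        : Fin (n G) → Fin (n H)
    f-surj   : ∀ b → ∃[ x ] f x ≡ b
    f-uv     : f u ≡ f v
    f-inj    : ∀ x y → f x ≡ f y → x ≡ y ⊎ ((x ≡ u ⊎ x ≡ v) × (y ≡ u ⊎ y ≡ v))
    f-adj    : ∀ a b → Edge H a b ⇔
                 (a ≢ b × ∃[ x ] ∃[ y ] (f x ≡ a × f y ≡ b × Edge G x y))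

_IsContractionOf_ : Graph → Graph → Set
H IsContractionOf G = Star ContractEdge G H

private
  small : ∀ {m} → Fin m → Bool
  small x = ⌊ toℕ x <? 2 ⌋

  isZero : ∀ {m} → Fin m → Bool
  isZero zero    = true
  isZero (suc _) = false

  xor-sym : ∀ a b → a xor b ≡ b xor a
  xor-sym false false = Relation.Binary.PropositionalEquality.refl
  xor-sym false true  = Relation.Binary.PropositionalEquality.refl
  xor-sym true  false = Relation.Binary.PropositionalEquality.refl
  xor-sym true  true  = Relation.Binary.PropositionalEquality.refl

  xor-self : ∀ a → a xor a ≡ false
  xor-self false = Relation.Binary.PropositionalEquality.refl
  xor-self true  = Relation.Binary.PropositionalEquality.refl

  eqF : ∀ {m} → Fin m → Fin m → Bool
  eqF x y = ⌊ x Data.Fin.≟ y ⌋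

  eqF-sym : ∀ {m} (x y : Fin m) → eqF x y ≡ eqF y x
  eqF-sym x y with x Data.Fin.≟ y | y Data.Fin.≟ x
  ... | Relation.Nullary.yes _ | Relation.Nullary.yes _ = Relation.Binary.PropositionalEquality.refl
  ... | Relation.Nullary.no _  | Relation.Nullary.no _  = Relation.Binary.PropositionalEquality.refl
  ... | Relation.Nullary.yes p | Relation.Nullary.no q  = Data.Empty.⊥-elim (q (Relation.Binary.PropositionalEquality.sym p))
    where import Data.Empty
  ... | Relation.Nullary.no q  | Relation.Nullary.yes p = Data.Empty.⊥-elim (q (Relation.Binary.PropositionalEquality.sym p))
    where import Data.Empty

  eqF-refl : ∀ {m} (x : Fin m) → eqF x x ≡ true
  eqF-refl x with x Data.Fin.≟ x
  ... | Relation.Nullary.yes _ = Relation.Binary.PropositionalEquality.refl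
  ... | Relation.Nullary.no q  = Data.Empty.⊥-elim (q Relation.Binary.PropositionalEquality.refl)
    where import Data.Empty

  ∨-sym : ∀ a b → (a ∨ b) ≡ (b ∨ a)
  ∨-sym false false = Relation.Binary.PropositionalEquality.refl
  ∨-sym false true  = Relation.Binary.PropositionalEquality.refl
  ∨-sym true  false = Relation.Binary.PropositionalEquality.refl
  ∨-sym true  true  = Relation.Binary.PropositionalEquality.refl

  notTrue∧ : ∀ a → (a ∧ false) ≡ false
  notTrue∧ false = Relation.Binary.PropositionalEquality.refl
  notTrue∧ true  = Relation.Binary.PropositionalEquality.refl

-- Complete bipartite graph K_{2,p}: vertices 0,1 form one side, 2..p+1 the other.
K2 : ℕ → Graph
K2 p = record
  { n = suc (suc p)
  ; adj = λ x y → small x xor small y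
  ; sym = λ x y → xor-sym (small x) (small y)
  ; irrefl = λ x → xor-self (small x)
  }

StarG : ℕ → Graph
StarG r = record
  { n = suc r
  ; adj = λ x y → isZero x xor isZero y
  ; sym = λ x y → xor-sym (isZero x) (isZero y)
  ; irrefl = λ x → xor-self (isZero x)
  }

-- D_r: edge {0,1} plus r pairwise non-adjacent vertices 2..r+1 adjacent to both 0 and 1.
D : ℕ → Graph
D r = record
  { n = suc (suc r)
  ; adj = λ x y → (small x ∨ small y) ∧ not (eqF x y)
  ; sym = λ x y → Relation.Binary.PropositionalEquality.cong₂ (λ a b → a ∧ not b)
                    (∨-sym (small x) (small y)) (eqF-sym x y)
  ; irrefl = λ x → Relation.Binary.PropositionalEquality.trans
               (Relation.Binary.PropositionalEquality.cong (λ b → (small x ∨ small x) ∧ not b) (eqF-refl x))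
               (notTrue∧ (small x ∨ small x))
  }

In𝒟 : Graph → Set
In𝒟 H = ∃[ r ] (H ≅ D r)

In𝒮 : Graph → Set
In𝒮 H = ∃[ r ] (H ≅ StarG r)

-- A graph is complete split with clique S when every vertex of S is adjacent to all
-- other vertices and every edge meets S; D_r and K_{1,r} are the complete split graphs
-- with a clique of two vertices and of one vertex respectively.  Contracting an edge of
-- a complete split graph gives a complete split graph whose clique is the image of the
-- old one, so both shapes are closed under contraction.  Contracting an edge of K_{2,p}
-- merges a vertex a of the 2-side with a vertex v of the p-side; the merged vertex is
-- then adjacent to everything, and so is the other vertex b of the 2-side, through v.
-- Hence every proper contraction of K_{2,p} lies in 𝒟 ∪ 𝒮.

module Submission where

open import Defs
open import Data.Nat as ℕ using (ℕ; _≤_)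
open import Data.Sum using (_⊎_)
open import Relation.Nullary using (¬_)

open import Data.Bool using (Bool; true; false)
open import Data.Empty using (⊥-elim)
open import Data.Fin using (Fin; zero; suc; _≟_)
open import Data.Fin.Permutation using (Permutation; transpose; _∘ₚ_; _⟨$⟩ʳ_)
import Data.Fin.Permutation.Components as PC
open import Data.Product using (∃-syntax; Σ-syntax; _×_; _,_; proj₁)
import Data.Product as Product
open import Data.Sum using (inj₁; inj₂; [_,_]′)
import Data.Sum as Sum
open import Data.Sum.Function.Propositional using (_⊎-⇔_)
open import Function.Bundles using (_⤖_; _⇔_; mk⇔; Bijection; Equivalence)
open import Function.Base using (id; _∘_)
open import Function.Construct.Composition using (_⇔-∘_)
open import Function.Construct.Identity using (⤖-id)
open import Function.Construct.Symmetry using (⇔-sym)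
open import Function.Properties.Inverse using (↔⇒⤖)
open import Level using (0ℓ)
open import Relation.Binary.PropositionalEquality using (_≡_; _≢_; refl; trans; cong)
import Relation.Binary.PropositionalEquality as ≡
open import Relation.Binary.Construct.Closure.ReflexiveTransitive using (Star; ε; _◅_)
open import Relation.Nullary using (yes; no)
open import Relation.Nullary.Decidable using (dec-true; dec-false)
open import Relation.Unary using (Pred; ｛_｝; _∪_; _≐_)

private
  variable
    G H : Graph

Edge-sym : ∀ G {x y} → Edge G x y → Edge G y x
Edge-sym G {x} {y} e = trans (Graph.sym G y x) e

Edge⇒≢ : ∀ G {x y} → Edge G x y → x ≢ y
Edge⇒≢ G {x} e refl with () ← trans (≡.sym e) (irrefl G x)

Dominating : (G : Graph) → Pred (Fin (n G)) 0ℓ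
Dominating G x = ∀ y → x ≢ y → Edge G x y

IsVertexCover : (G : Graph) → Pred (Fin (n G)) 0ℓ → Set
IsVertexCover G S = ∀ {x y} → Edge G x y → S x ⊎ S y

record IsCompleteSplit (G : Graph) (S : Pred (Fin (n G)) 0ℓ) : Set where
  field
    dominating : ∀ {x} → S x → Dominating G x
    cover      : IsVertexCover G S

record IsCompleteBipartite (G : Graph) (S : Pred (Fin (n G)) 0ℓ) : Set where
  field
    cross       : ∀ {x y} → S x → ¬ S y → Edge G x y
    cover       : IsVertexCover G S
    independent : ∀ {x y} → S x → S y → ¬ Edge G x y

IsCompleteSplit-resp : ∀ {S T} → S ≐ T → IsCompleteSplit G S → IsCompleteSplit G T
IsCompleteSplit-resp (S⊆T , T⊆S) split = record
  { dominating = λ x∈T → dominating (T⊆S x∈T)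
  ; cover      = λ e → Sum.map S⊆T S⊆T (cover e)
  }
  where open IsCompleteSplit split

IsCompleteBipartite-resp : ∀ {S T} → S ≐ T → IsCompleteBipartite G S → IsCompleteBipartite G T
IsCompleteBipartite-resp (S⊆T , T⊆S) bip = record
  { cross       = λ x∈T y∉T → cross (T⊆S x∈T) (λ y∈S → y∉T (S⊆T y∈S))
  ; cover       = λ e → Sum.map S⊆T S⊆T (cover e)
  ; independent = λ x∈T y∈T → independent (T⊆S x∈T) (T⊆S y∈T)
  }
  where open IsCompleteBipartite bip

split-edge : ∀ {S} → IsCompleteSplit G S → ∀ {x y} → Edge G x y ⇔ (x ≢ y × (S x ⊎ S y))
split-edge {G} split {x} {y} = mk⇔ (λ e → Edge⇒≢ G e , cover e) from
  where
    open IsCompleteSplit split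
    from : x ≢ y × (_ ⊎ _) → Edge G x y
    from (x≢y , inj₁ x∈S) = dominating x∈S y x≢y
    from (x≢y , inj₂ y∈S) = Edge-sym G (dominating y∈S x (λ y≡x → x≢y (≡.sym y≡x)))

StarShaped : Graph → Set
StarShaped G = ∃[ c ] IsCompleteSplit G ｛ c ｝

DShaped : Graph → Set
DShaped G = ∃[ a ] ∃[ b ] a ≢ b × IsCompleteSplit G (｛ a ｝ ∪ ｛ b ｝)

pair-shape : ∀ {a b} → IsCompleteSplit G (｛ a ｝ ∪ ｛ b ｝) → DShaped G ⊎ StarShaped G
pair-shape {a = a} {b} split with a ≟ b
... | no a≢b  = inj₁ (a , b , a≢b , split)
... | yes refl = inj₂ (a , IsCompleteSplit-resp ([ id , id ]′ , inj₁) split)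

ContractEdge-swap : ContractEdge G H → ContractEdge G H
ContractEdge-swap {G} ce = record
  { u      = v
  ; v      = u
  ; uv     = Edge-sym G uv
  ; f      = f
  ; f-surj = f-surj
  ; f-uv   = ≡.sym f-uv
  ; f-inj  = λ x y fx≡fy → Sum.map₂ (Product.map Sum.swap Sum.swap) (f-inj x y fx≡fy)
  ; f-adj  = f-adj
  }
  where open ContractEdge ce

module Contraction (ce : ContractEdge G H) where
  open ContractEdge ce

  image : Pred (Fin (n G)) 0ℓ → Pred (Fin (n H)) 0ℓ
  image S β = ∃[ x ] S x × f x ≡ β

  image-｛｝ : ∀ {a} → image ｛ a ｝ ≐ ｛ f a ｝
  image-｛｝ = (λ { (_ , refl , fa≡β) → fa≡β }) , (λ fa≡β → _ , refl , fa≡β)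

  image-pair : ∀ {a b} → image (｛ a ｝ ∪ ｛ b ｝) ≐ ｛ f a ｝ ∪ ｛ f b ｝
  image-pair = (λ { (_ , inj₁ refl , fa≡β) → inj₁ fa≡β ; (_ , inj₂ refl , fb≡β) → inj₂ fb≡β })
             , [ (λ fa≡β → _ , inj₁ refl , fa≡β) , (λ fb≡β → _ , inj₂ refl , fb≡β) ]′

  image-cover : ∀ {S} → IsVertexCover G S → IsVertexCover H (image S)
  image-cover cover e with Equivalence.to (f-adj _ _) e
  ... | _ , x , y , fx≡α , fy≡β , e′ =
    Sum.map (λ x∈S → x , x∈S , fx≡α) (λ y∈S → y , y∈S , fy≡β) (cover e′)

  image-dominating : ∀ {α} →
    (∀ y → α ≢ f y → ∃[ x ] ∃[ y′ ] f x ≡ α × f y′ ≡ f y × Edge G x y′) → Dominating H α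
  image-dominating {α} reach β α≢β with f-surj β
  ... | y , fy≡β with reach y (λ α≡fy → α≢β (trans α≡fy fy≡β))
  ...   | x , y′ , fx≡α , fy′≡fy , e =
    Equivalence.from (f-adj α β) (α≢β , x , y′ , fx≡α , trans fy′≡fy fy≡β , e)

  image-split : ∀ {S} → IsCompleteSplit G S → IsCompleteSplit H (image S)
  image-split split = record
    { dominating = λ { (x , x∈S , refl) → image-dominating λ y fx≢fy →
                       x , y , refl , refl , dominating x∈S y (λ x≡y → fx≢fy (cong f x≡y)) }
    ; cover      = image-cover cover
    }
    where open IsCompleteSplit split

  bipartite-pair-contract : ∀ {a b} → IsCompleteBipartite G (｛ a ｝ ∪ ｛ b ｝) → a ≢ b → a ≡ u → DShaped H
  bipartite-pair-contract {a} {b} bip a≢b refl = f a , f b , fa≢fb , record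
    { dominating = λ { (inj₁ refl) → image-dominating reach-from-a
                     ; (inj₂ refl) → image-dominating reach-from-b }
    ; cover      = λ e → Sum.map (proj₁ image-pair) (proj₁ image-pair) (image-cover cover e)
    }
    where
      open IsCompleteBipartite bip

      v∉S : ¬ (a ≡ v ⊎ b ≡ v)
      v∉S v∈S = independent (inj₁ refl) v∈S uv

      fa≢fb : f a ≢ f b
      fa≢fb fa≡fb with f-inj a b fa≡fb
      ... | inj₁ a≡b             = a≢b a≡b
      ... | inj₂ (_ , inj₁ b≡a) = a≢b (≡.sym b≡a)
      ... | inj₂ (_ , inj₂ b≡v) = v∉S (inj₂ b≡v)

      -- The class of a also contains v, which is adjacent to b.
      reach-from-a : ∀ y → f a ≢ f y → ∃[ x ] ∃[ y′ ] f x ≡ f a × f y′ ≡ f y × Edge G x y′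
      reach-from-a y fa≢fy with a ≟ y | b ≟ y
      ... | yes refl | _        = ⊥-elim (fa≢fy refl)
      ... | no _     | yes refl = v , b , ≡.sym f-uv , refl , Edge-sym G (cross (inj₂ refl) v∉S)
      ... | no a≢y   | no b≢y   = a , y , refl , refl , cross (inj₁ refl) [ a≢y , b≢y ]′

      reach-from-b : ∀ y → f b ≢ f y → ∃[ x ] ∃[ y′ ] f x ≡ f b × f y′ ≡ f y × Edge G x y′
      reach-from-b y fb≢fy with a ≟ y | b ≟ y
      ... | yes refl | _        = b , v , refl , ≡.sym f-uv , cross (inj₂ refl) v∉S
      ... | no _     | yes refl = ⊥-elim (fb≢fy refl)
      ... | no a≢y   | no b≢y   = b , y , refl , refl , cross (inj₂ refl) [ a≢y , b≢y ]′

StarShaped-contract : ContractEdge G H → StarShaped G → StarShaped H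
StarShaped-contract ce (c , split) = f c , IsCompleteSplit-resp image-｛｝ (image-split split)
  where
    open ContractEdge ce
    open Contraction ce

DShaped-contract : ContractEdge G H → DShaped G → DShaped H ⊎ StarShaped H
DShaped-contract ce (_ , _ , _ , split) = pair-shape (IsCompleteSplit-resp image-pair (image-split split))
  where open Contraction ce

contractions-shape : Star ContractEdge G H → DShaped G ⊎ StarShaped G → DShaped H ⊎ StarShaped H
contractions-shape ε          shape      = shape
contractions-shape (ce ◅ ces) (inj₁ d) = contractions-shape ces (DShaped-contract ce d)
contractions-shape (ce ◅ ces) (inj₂ s) = contractions-shape ces (inj₂ (StarShaped-contract ce s))

K2-bipartite : ∀ p → IsCompleteBipartite (K2 p) (｛ zero ｝ ∪ ｛ suc zero ｝)
K2-bipartite p = record { cross = cross ; cover = cover ; independent = independent }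
  where
    cross : ∀ {x y} → (zero ≡ x ⊎ suc zero ≡ x) → ¬ (zero ≡ y ⊎ suc zero ≡ y) → Edge (K2 p) x y
    cross {y = zero}          _ y∉S = ⊥-elim (y∉S (inj₁ refl))
    cross {y = suc zero}      _ y∉S = ⊥-elim (y∉S (inj₂ refl))
    cross {y = suc (suc _)} (inj₁ refl) _ = refl
    cross {y = suc (suc _)} (inj₂ refl) _ = refl

    cover : IsVertexCover (K2 p) (｛ zero ｝ ∪ ｛ suc zero ｝)
    cover {zero}                      _ = inj₁ (inj₁ refl)
    cover {suc zero}                  _ = inj₁ (inj₂ refl)
    cover {suc (suc _)} {zero}        _ = inj₂ (inj₁ refl)
    cover {suc (suc _)} {suc zero}    _ = inj₂ (inj₂ refl)
    cover {suc (suc _)} {suc (suc _)} ()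

    independent : ∀ {x y} → (zero ≡ x ⊎ suc zero ≡ x) → (zero ≡ y ⊎ suc zero ≡ y) → ¬ Edge (K2 p) x y
    independent (inj₁ refl) (inj₁ refl) ()
    independent (inj₁ refl) (inj₂ refl) ()
    independent (inj₂ refl) (inj₁ refl) ()
    independent (inj₂ refl) (inj₂ refl) ()

K2-contract : ∀ {p} → ContractEdge (K2 p) H → DShaped H
K2-contract {H} {p} ce =
  [ at-endpoint ce , at-endpoint (ContractEdge-swap ce) ]′
    (IsCompleteBipartite.cover (K2-bipartite p) (ContractEdge.uv ce))
  where
    at-endpoint : (ce : ContractEdge (K2 p) H) →
      (zero ≡ ContractEdge.u ce ⊎ suc zero ≡ ContractEdge.u ce) → DShaped H
    at-endpoint ce (inj₁ 0≡u) = Contraction.bipartite-pair-contract ce (K2-bipartite p) (λ ()) 0≡u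
    at-endpoint ce (inj₂ 1≡u) =
      Contraction.bipartite-pair-contract ce
        (IsCompleteBipartite-resp (Sum.swap , Sum.swap) (K2-bipartite p)) (λ ()) 1≡u

bool-ext : ∀ {b c : Bool} → b ≡ true ⇔ c ≡ true → b ≡ c
bool-ext {false} {false} _   = refl
bool-ext {false} {true}  b⇔c = Equivalence.from b⇔c refl
bool-ext {true}  {false} b⇔c = ≡.sym (Equivalence.to b⇔c refl)
bool-ext {true}  {true}  _   = refl

≅-refl : G ≅ G
≅-refl {G} = record { bij = ⤖-id (Fin (n G)) ; preserve = λ _ _ → refl }

split-≅ : ∀ {S T} → IsCompleteSplit G S → IsCompleteSplit H T →
  (π : Fin (n G) ⤖ Fin (n H)) → (∀ {x} → S x ⇔ T (Bijection.to π x)) → G ≅ H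
split-≅ {G} {H} {S} {T} splitG splitH π S⇔T = record
  { bij      = π
  ; preserve = λ x y → bool-ext (⇔-sym (split-edge splitH) ⇔-∘ (transport ⇔-∘ split-edge splitG))
  }
  where
    open Bijection π using (to; injective)
    transport : ∀ {x y} → (x ≢ y × (S x ⊎ S y)) ⇔ (to x ≢ to y × (T (to x) ⊎ T (to y)))
    transport = mk⇔
      (Product.map (λ x≢y → x≢y ∘ injective)  (Sum.map (Equivalence.to S⇔T) (Equivalence.to S⇔T)))
      (Product.map (λ πx≢πy → πx≢πy ∘ cong to) (Sum.map (Equivalence.from S⇔T) (Equivalence.from S⇔T)))

D-split : ∀ r → IsCompleteSplit (D r) (｛ zero ｝ ∪ ｛ suc zero ｝)
D-split r = record { dominating = dominating ; cover = cover }
  where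
    dominating : ∀ {x} → (zero ≡ x ⊎ suc zero ≡ x) → Dominating (D r) x
    dominating (inj₁ refl) zero          0≢0 = ⊥-elim (0≢0 refl)
    dominating (inj₁ refl) (suc _)       _   = refl
    dominating (inj₂ refl) zero          _   = refl
    dominating (inj₂ refl) (suc zero)    1≢1 = ⊥-elim (1≢1 refl)
    dominating (inj₂ refl) (suc (suc _)) _   = refl

    cover : IsVertexCover (D r) (｛ zero ｝ ∪ ｛ suc zero ｝)
    cover {zero}                      _ = inj₁ (inj₁ refl)
    cover {suc zero}                  _ = inj₁ (inj₂ refl)
    cover {suc (suc _)} {zero}        _ = inj₂ (inj₁ refl)
    cover {suc (suc _)} {suc zero}    _ = inj₂ (inj₂ refl)
    cover {suc (suc _)} {suc (suc _)} ()

Star-split : ∀ r → IsCompleteSplit (StarG r) ｛ zero ｝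
Star-split r = record { dominating = dominating ; cover = cover }
  where
    dominating : ∀ {x} → zero ≡ x → Dominating (StarG r) x
    dominating refl zero    0≢0 = ⊥-elim (0≢0 refl)
    dominating refl (suc _) _   = refl

    cover : IsVertexCover (StarG r) ｛ zero ｝
    cover {zero}          _ = inj₁ refl
    cover {suc _} {zero}  _ = inj₂ refl
    cover {suc _} {suc _} ()

point-⇔ : ∀ {A B : Set} (π : A ⤖ B) {a c} → Bijection.to π a ≡ c → ∀ {x} → a ≡ x ⇔ c ≡ Bijection.to π x
point-⇔ π πa≡c = mk⇔ (λ { refl → ≡.sym πa≡c }) (λ c≡πx → Bijection.injective π (trans πa≡c c≡πx))

transpose-ˡ : ∀ {m} (i j : Fin m) → PC.transpose i j i ≡ j
transpose-ˡ i j rewrite dec-true (i ≟ i) refl = refl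

transpose-other : ∀ {m} {i j k : Fin m} → k ≢ i → k ≢ j → PC.transpose i j k ≡ k
transpose-other {i = i} {j} {k} k≢i k≢j rewrite dec-false (k ≟ i) k≢i | dec-false (k ≟ j) k≢j = refl

point-to-zero : ∀ {m} (c : Fin m) → ∃[ r ] Σ[ π ∈ Fin m ⤖ Fin (ℕ.suc r) ] Bijection.to π c ≡ zero
point-to-zero {ℕ.suc r} c = r , ↔⇒⤖ (transpose c zero) , transpose-ˡ c zero

pair-to-01 : ∀ {m} {a b : Fin m} → a ≢ b →
  ∃[ r ] Σ[ π ∈ Fin m ⤖ Fin (ℕ.2+ r) ] Bijection.to π a ≡ zero × Bijection.to π b ≡ suc zero
pair-to-01 {ℕ.suc ℕ.zero} {zero} {zero} a≢b = ⊥-elim (a≢b refl)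
pair-to-01 {ℕ.2+ r}       {a}    {b}    a≢b = r , ↔⇒⤖ (τ ∘ₚ σ) , πa≡0 , transpose-ˡ b′ (suc zero)
  where
    τ : Permutation (ℕ.2+ r) (ℕ.2+ r)
    τ = transpose a zero
    b′ : Fin (ℕ.2+ r)
    b′ = τ ⟨$⟩ʳ b
    σ : Permutation (ℕ.2+ r) (ℕ.2+ r)
    σ = transpose b′ (suc zero)
    0≢b′ : zero ≢ b′
    0≢b′ 0≡b′ = a≢b (Bijection.injective (↔⇒⤖ τ) (trans (transpose-ˡ a zero) 0≡b′))
    πa≡0 : σ ⟨$⟩ʳ (τ ⟨$⟩ʳ a) ≡ zero
    πa≡0 = trans (cong (σ ⟨$⟩ʳ_) (transpose-ˡ a zero)) (transpose-other 0≢b′ (λ ()))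

DShaped⇒In𝒟 : DShaped H → In𝒟 H
DShaped⇒In𝒟 (a , b , a≢b , split) with pair-to-01 a≢b
... | r , π , πa≡0 , πb≡1 = r , split-≅ split (D-split r) π (point-⇔ π πa≡0 ⊎-⇔ point-⇔ π πb≡1)

StarShaped⇒In𝒮 : StarShaped H → In𝒮 H
StarShaped⇒In𝒮 (c , split) with point-to-zero c
... | r , π , πc≡0 = r , split-≅ split (Star-split r) π (point-⇔ π πc≡0)

lemma2 : (p : ℕ) → 2 ≤ p → (H : Graph) → H IsContractionOf K2 p →
    ¬ (H ≅ K2 p) → In𝒟 H ⊎ In𝒮 H
lemma2 p _ H ε          H≇K2 = ⊥-elim (H≇K2 ≅-refl)
lemma2 p _ H (ce ◅ ces) _    =
  Sum.map DShaped⇒In𝒟 StarShaped⇒In𝒮 (contractions-shape ces (inj₁ (K2-contract ce)))
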